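{- If $G$ is a graph of order $n$, then $\operatorname{lb}_1(G)\leq\frac{n-1}{2}$, with equality if and only if $G$ is a conference graph.
   Context: All graphs are finite and simple. A graph is strongly regular with parameters $(n,d,\lambda,\mu)$ if it has $n$ vertices, is $d$-regular, any two adjacent vertices have exactly $\lambda$ common neighbors and any two distinct non-adjacent vertices have exactly $\mu$ common neighbors. A conference graph is a strongly regular graph with parameters $(n,\frac{n-1}{2},\frac{n-5}{4},\frac{n-1}{4})$. A trigraph is a graph whose edges are colored red or black; a graph is a trigraph with all edges black. For a partition $\mathcal{P}$ of $V(G)$, the quotient trigraph $G/\mathcal{P}$ has vertex set $\mathcal{P}$; two parts $U,W$ are joined by a black edge if every pair $u\in U,w\in W$ is an edge, are non-adjacent if no such pair is an edge, and are joined by a red edge otherwise. For $G$ with at least two vertices, $\operatorname{lb}_1(G)$ is the minimum, over all pairs of distinct vertices $u,v$, of the maximum red degree (number of incident red edges) of $G/\mathcal{P}$, where $\mathcal{P}$ is the partition whose only non-singleton part is $\{u,v\}$; for a one-vertex graph $\operatorname{lb}_1(G)=0$. -}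

module Defs where

open import Data.Bool using (Bool; true; false; _∧_; not; if_then_else_)
open import Data.Nat using (ℕ; zero; suc; _+_; _*_; _∸_; _⊓_; _⊔_)
open import Data.Fin using (Fin; _≟_)
open import Data.List using (List; []; _∷_; foldr; filterᵇ; length; map; concatMap; allFin)
open import Data.Bool.ListAction using (any; all)
open import Relation.Nullary using (¬_; does)
open import Relation.Binary.PropositionalEquality using (_≡_)
open import Data.Product using (_×_)

record Graph (n : ℕ) : Set where
  field
    adj     : Fin n → Fin n → Bool
    adj-sym : ∀ x y → adj x y ≡ adj y x
    irrefl  : ∀ x → adj x x ≡ false
open Graph public

_==_ : ∀ {n} → Fin n → Fin n → Bool
x == y = does (x ≟ y)

count : ∀ {n} → (Fin n → Bool) → ℕ
count {n} p = length (filterᵇ p (allFin n))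

maxL : List ℕ → ℕ
maxL = foldr _⊔_ 0

minL : List ℕ → ℕ
minL []       = 0
minL (x ∷ xs) = foldr _⊓_ x xs

module _ {n : ℕ} (G : Graph n) where

  degree : Fin n → ℕ
  degree x = count (λ y → adj G x y)

  commonNbrs : Fin n → Fin n → ℕ
  commonNbrs x y = count (λ z → adj G x z ∧ adj G y z)

  -- Conference graph: strongly regular with parameters
  -- (n, (n-1)/2, (n-5)/4, (n-1)/4), parameters written multiplied out.
  Conference : Set
  Conference =
    (∀ x → 2 * degree x + 1 ≡ n)
    × (∀ x y → ¬ (x ≡ y) → adj G x y ≡ true  → 4 * commonNbrs x y + 5 ≡ n)
    × (∀ x y → ¬ (x ≡ y) → adj G x y ≡ false → 4 * commonNbrs x y + 1 ≡ n)

  -- Quotient trigraph G/P where P has the single non-singleton part {u,v}.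
  -- Each part is named by a representative: the part of x is rep x
  -- (v is sent to u); the parts are exactly the p with p ≠ v.
  module Quot (u v : Fin n) where

    rep : Fin n → Fin n
    rep x = if x == v then u else x

    isPart : Fin n → Bool
    isPart p = not (p == v)

    inPart : Fin n → Fin n → Bool
    inPart p x = rep x == p

    someEdge : Fin n → Fin n → Bool
    someEdge p q = any (λ x → any (λ y → inPart p x ∧ inPart q y ∧ adj G x y) (allFin n)) (allFin n)

    allEdge : Fin n → Fin n → Bool
    allEdge p q = all (λ x → all (λ y → not (inPart p x ∧ inPart q y) Data.Bool.∨ adj G x y) (allFin n)) (allFin n)

    red : Fin n → Fin n → Bool
    red p q = not (p == q) ∧ someEdge p q ∧ not (allEdge p q)

    redDegree : Fin n → ℕ
    redDegree p = count (λ q → isPart q ∧ red p q)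

    maxRedDegree : ℕ
    maxRedDegree = maxL (map redDegree (filterᵇ isPart (allFin n)))

  -- lb₁ G: minimum over pairs of distinct vertices u,v of the maximum red
  -- degree of the quotient; 0 when there is no such pair (one-vertex graph).
  lb₁ : ℕ
  lb₁ = minL (concatMap (λ u → concatMap (λ v →
          if u == v then [] else (Quot.maxRedDegree u v ∷ [])) (allFin n)) (allFin n))

{-# OPTIONS --safe #-}

-- Merging two distinct vertices u and v yields a trigraph whose maximum red degree is the number
-- of vertices outside {u, v} adjacent to exactly one of u and v: the merged part is red exactly to
-- those vertices, and every other part can be red only to the merged part.  So lb₁ is the minimum
-- of that count over pairs.  Counting the triples (u, v, w) in which w is adjacent to exactly one
-- of u, v, grouped by w, gives
--   ∑_{u ≠ v} |N(u) Δ N(v) ∖ {u, v}| = ∑_w 2 d(w) (n - 1 - d(w)) ≤ n (n - 1)² / 2   (AM-GM),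
-- while the left side is at least n (n - 1) lb₁.  Equality forces d(w) = (n - 1)/2 for every w and
-- |N(u) Δ N(v) ∖ {u, v}| = (n - 1)/2 for every pair u ≠ v; since that count equals
-- d(u) + d(v) - 2 |N(u) ∩ N(v)| - 2 [u ~ v], this is exactly the conference condition, and conversely.

module Submission where

open import Defs
open import Data.Nat using (ℕ; _*_; _∸_; _≤_)
open import Data.Product using (_×_)
open import Function.Bundles using (_⇔_)
open import Relation.Binary.PropositionalEquality using (_≡_)

open import Data.Nat.Properties hiding (_≟_)
open import Algebra.Properties.Semiring.Sum +-*-semiring
  using (sum; sum-syntax; sum-cong-≗; sum-replicate-zero; sum-remove; ∑-distrib-+; ∑-comm;
         *-distribˡ-sum; *-distribʳ-sum)
open import Data.Bool using (Bool; true; false; not; _∧_; _∨_; _xor_; T; if_then_else_)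
open import Data.Bool.ListAction using (any; all)
open import Data.Bool.Properties using (T-∧; T?)
open import Data.Empty using (⊥-elim)
open import Data.Fin using (Fin; zero; suc; _≟_; punchIn)
open import Data.Fin.Properties using (punchInᵢ≢i)
open import Data.List using (List; []; _∷_; length; filterᵇ; tabulate; map; concatMap; allFin)
open import Data.List.Membership.Propositional using (_∈_; lose; find)
open import Data.List.Membership.Propositional.Properties
  using (∈-allFin; ∈-concatMap⁺; ∈-concatMap⁻; ∈-map∘filter⁺; ∈-map∘filter⁻; foldr-selective)
open import Data.List.Properties using (foldr-preservesᵇ; foldr-preservesᵒ)
open import Data.List.Relation.Unary.All as All using (All)
open import Data.List.Relation.Unary.All.Properties using (all⁺; all⁻)
open import Data.List.Relation.Unary.Any as Any using (here; there)
open import Data.List.Relation.Unary.Any.Properties using (any⁺; any⁻)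
open import Data.Nat using (zero; suc; _+_; z≤n; ∣_-_∣)
open import Data.Nat.Tactic.RingSolver using (solve-∀)
open import Data.Product using (_,_; ∃; ∃-syntax)
open import Data.Sum using (_⊎_; inj₁; inj₂; [_,_]; reduce)
open import Data.Unit using (tt)
open import Function using (_∘_)
open import Function.Bundles using (mk⇔; Equivalence)
open import Relation.Binary.PropositionalEquality
  using (_≢_; _≗_; refl; sym; trans; cong; cong₂; subst; subst₂; ≢-sym; module ≡-Reasoning)
open import Relation.Nullary using (yes; no)
open import Relation.Nullary.Decidable using (dec-true; dec-false)

open Equivalence using (to; from)

𝟙 : Bool → ℕ
𝟙 true  = 1
𝟙 false = 0

𝟙-∧ : ∀ a b → 𝟙 (a ∧ b) ≡ 𝟙 a * 𝟙 b
𝟙-∧ false _ = refl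
𝟙-∧ true  b = sym (+-identityʳ (𝟙 b))

sum-const : ∀ n k → ∑[ i < n ] k ≡ n * k
sum-const zero    k = refl
sum-const (suc n) k = cong (k +_) (sum-const n k)

sum-mono-≤ : ∀ {n} {f g : Fin n → ℕ} → (∀ i → f i ≤ g i) → sum f ≤ sum g
sum-mono-≤ {zero}  _   = z≤n
sum-mono-≤ {suc n} f≤g = +-mono-≤ (f≤g zero) (sum-mono-≤ (f≤g ∘ suc))

≤-sum : ∀ {n} (f : Fin n → ℕ) i → f i ≤ sum f
≤-sum f zero    = m≤m+n _ _
≤-sum f (suc i) = ≤-trans (≤-sum (f ∘ suc) i) (m≤n+m _ _)

sum-tight : ∀ {n} {f g : Fin n → ℕ} → (∀ i → f i ≤ g i) → sum g ≤ sum f → f ≗ g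
sum-tight {suc n} {f} {g} f≤g Σg≤Σf zero    =
  ≤-antisym (f≤g zero) (+-cancelʳ-≤ _ _ _ (≤-trans Σg≤Σf (+-monoʳ-≤ (f zero) (sum-mono-≤ (f≤g ∘ suc)))))
sum-tight {suc n} {f} {g} f≤g Σg≤Σf (suc i) =
  sum-tight (f≤g ∘ suc) (+-cancelˡ-≤ (g zero) _ _ (≤-trans Σg≤Σf (+-monoˡ-≤ _ (f≤g zero)))) i

sum-product : ∀ {m n} (f : Fin m → ℕ) (g : Fin n → ℕ) →
  ∑[ i < m ] ∑[ j < n ] (f i * g j) ≡ sum f * sum g
sum-product {m} {n} f g = begin
  ∑[ i < m ] ∑[ j < n ] (f i * g j)  ≡⟨ sum-cong-≗ (λ i → *-distribˡ-sum (f i) g) ⟨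
  ∑[ i < m ] (f i * sum g)          ≡⟨ *-distribʳ-sum (sum g) f ⟨
  sum f * sum g                     ∎
  where open ≡-Reasoning

sum-product-sym : ∀ {n} (f g : Fin n → ℕ) →
  ∑[ i < n ] ∑[ j < n ] (f i * g j + g i * f j) ≡ 2 * (sum f * sum g)
sum-product-sym {n} f g = begin
  ∑[ i < n ] ∑[ j < n ] (f i * g j + g i * f j)
    ≡⟨ sum-cong-≗ (λ i → ∑-distrib-+ (λ j → f i * g j) (λ j → g i * f j)) ⟩
  ∑[ i < n ] (∑[ j < n ] (f i * g j) + ∑[ j < n ] (g i * f j))
    ≡⟨ ∑-distrib-+ (λ i → ∑[ j < n ] (f i * g j)) (λ i → ∑[ j < n ] (g i * f j)) ⟩
  ∑[ i < n ] ∑[ j < n ] (f i * g j) + ∑[ i < n ] ∑[ j < n ] (g i * f j)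
    ≡⟨ cong₂ _+_ (sum-product f g) (sum-product g f) ⟩
  sum f * sum g + sum g * sum f
    ≡⟨ cong (sum f * sum g +_) (trans (*-comm (sum g) (sum f)) (sym (+-identityʳ _))) ⟩
  2 * (sum f * sum g)
    ∎
  where open ≡-Reasoning

==-refl : ∀ {n} (i : Fin n) → (i == i) ≡ true
==-refl i = dec-true (i ≟ i) refl

≢⇒==-false : ∀ {n} {i j : Fin n} → i ≢ j → (i == j) ≡ false
≢⇒==-false = dec-false (_ ≟ _)

T-== : ∀ {n} {i j : Fin n} → T (i == j) ⇔ i ≡ j
T-== {i = i} {j} with i ≟ j
... | yes i≡j = mk⇔ (λ _ → i≡j) (λ _ → tt)
... | no  i≢j = mk⇔ (λ ()) (λ i≡j → i≢j i≡j)

T-not-== : ∀ {n} {i j : Fin n} → T (not (i == j)) ⇔ i ≢ j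
T-not-== {i = i} {j} with i ≟ j
... | yes i≡j = mk⇔ (λ ()) (λ i≢j → i≢j i≡j)
... | no  i≢j = mk⇔ (λ _ → i≢j) (λ _ → tt)

sum-𝟙-== : ∀ {n} (i : Fin n) → ∑[ j < n ] 𝟙 (j == i) ≡ 1
sum-𝟙-== {suc n} zero    = cong suc (sum-replicate-zero n)
sum-𝟙-== {suc n} (suc i) = sum-𝟙-== i

sum-𝟙-not-== : ∀ {m} (i : Fin (suc m)) → ∑[ j < suc m ] 𝟙 (not (j == i)) ≡ m
sum-𝟙-not-== {m} i = begin
  ∑[ j < suc m ] 𝟙 (not (j == i))
    ≡⟨ sum-remove {i = i} (λ j → 𝟙 (not (j == i))) ⟩
  𝟙 (not (i == i)) + ∑[ j < m ] 𝟙 (not (punchIn i j == i))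
    ≡⟨ cong₂ _+_ (cong (𝟙 ∘ not) (==-refl i))
                 (sum-cong-≗ λ j → cong (𝟙 ∘ not) (≢⇒==-false (punchInᵢ≢i i j))) ⟩
  ∑[ j < m ] 1
    ≡⟨ sum-const m 1 ⟩
  m * 1
    ≡⟨ *-identityʳ m ⟩
  m ∎
  where open ≡-Reasoning

length-filterᵇ-tabulate : ∀ {m} {A : Set} (p : A → Bool) (f : Fin m → A) →
  length (filterᵇ p (tabulate f)) ≡ ∑[ i < m ] 𝟙 (p (f i))
length-filterᵇ-tabulate {zero}  p f = refl
length-filterᵇ-tabulate {suc m} p f with p (f zero)
... | true  = cong suc (length-filterᵇ-tabulate p (f ∘ suc))
... | false = length-filterᵇ-tabulate p (f ∘ suc)

count-sum : ∀ {n} (p : Fin n → Bool) → count p ≡ ∑[ i < n ] 𝟙 (p i)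
count-sum p = length-filterᵇ-tabulate p (λ i → i)

count-cong : ∀ {n} {p q : Fin n → Bool} → p ≗ q → count p ≡ count q
count-cong {p = p} {q} p≗q = trans (count-sum p) (trans (sum-cong-≗ (cong 𝟙 ∘ p≗q)) (sym (count-sum q)))

𝟙≤count : ∀ {n} (p : Fin n → Bool) i → 𝟙 (p i) ≤ count p
𝟙≤count p i = ≤-trans (≤-sum (𝟙 ∘ p) i) (≤-reflexive (sym (count-sum p)))

T-ext : ∀ {a b} → (T a → T b) → (T b → T a) → a ≡ b
T-ext {false} {false} _   _   = refl
T-ext {false} {true}  _   b⇒a = ⊥-elim (b⇒a tt)
T-ext {true}  {false} a⇒b _   = ⊥-elim (a⇒b tt)
T-ext {true}  {true}  _   _   = refl

T-not∨⇔→ : ∀ {a b} → T (not a ∨ b) ⇔ (T a → T b)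
T-not∨⇔→ {false} = mk⇔ (λ _ ()) (λ _ → tt)
T-not∨⇔→ {true}  = mk⇔ (λ b _ → b) (λ a⇒b → a⇒b tt)

T-any-allFin : ∀ {n} {p : Fin n → Bool} → T (any p (allFin n)) ⇔ ∃ (T ∘ p)
T-any-allFin {n} {p} =
  mk⇔ (Any.satisfied ∘ any⁻ p (allFin n)) (λ (i , pi) → any⁺ {xs = allFin n} p (lose (∈-allFin i) pi))

T-all-allFin : ∀ {n} {p : Fin n → Bool} → T (all p (allFin n)) ⇔ (∀ i → T (p i))
T-all-allFin {n} {p} =
  mk⇔ (λ t i → All.lookup (all⁺ p _ t) (∈-allFin i)) (λ h → all⁻ p {allFin n} (All.tabulate (λ {i} _ → h i)))

maxL-≤ : ∀ {b xs} → All (_≤ b) xs → maxL xs ≤ b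
maxL-≤ {b} = foldr-preservesᵇ {P = _≤ b} ⊔-lub z≤n

≤-maxL : ∀ {x xs} → x ∈ xs → x ≤ maxL xs
≤-maxL {x} {xs} x∈xs =
  foldr-preservesᵒ {P = x ≤_} (λ a b → [ m≤n⇒m≤n⊔o b , m≤n⇒m≤o⊔n a ]) 0 xs (inj₂ (Any.map ≤-reflexive x∈xs))

minL-≤ : ∀ {x xs} → x ∈ xs → minL xs ≤ x
minL-≤ {x} {y ∷ ys} x∈xs =
  foldr-preservesᵒ {P = _≤ x} (λ a b → [ m≤n⇒m⊓o≤n b , m≤n⇒o⊓m≤n a ]) y ys (head-or-tail x∈xs)
  where
  head-or-tail : x ∈ y ∷ ys → y ≤ x ⊎ Any.Any (_≤ x) ys
  head-or-tail (here x≡y)   = inj₁ (≤-reflexive (sym x≡y))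
  head-or-tail (there x∈ys) = inj₂ (Any.map (≤-reflexive ∘ sym) x∈ys)

minL-∈ : ∀ {x xs} → x ∈ xs → minL xs ∈ xs
minL-∈ {xs = y ∷ ys} _ with foldr-selective ⊓-sel y ys
... | inj₁ min≡y  = here min≡y
... | inj₂ min∈ys = there min∈ys

square-of-sum-≤ : ∀ {a b} → a ≤ b → (a + b) * (a + b) ≡ 4 * (a * b) + ∣ a - b ∣ * ∣ a - b ∣
square-of-sum-≤ {a} {b} a≤b rewrite m≤n⇒∣m-n∣≡n∸m a≤b =
  subst (λ c → (a + c) * (a + c) ≡ 4 * (a * c) + (b ∸ a) * (b ∸ a)) (m+[n∸m]≡n a≤b) (expand a (b ∸ a))
  where
  expand : ∀ a k → (a + (a + k)) * (a + (a + k)) ≡ 4 * (a * (a + k)) + k * k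
  expand = solve-∀

square-of-sum : ∀ a b → (a + b) * (a + b) ≡ 4 * (a * b) + ∣ a - b ∣ * ∣ a - b ∣
square-of-sum a b with ≤-total a b
... | inj₁ a≤b = square-of-sum-≤ a≤b
... | inj₂ b≤a rewrite +-comm a b | *-comm a b | ∣-∣-comm a b = square-of-sum-≤ b≤a

am-gm : ∀ a b → 4 * (a * b) ≤ (a + b) * (a + b)
am-gm a b = ≤-trans (m≤m+n _ _) (≤-reflexive (sym (square-of-sum a b)))

am-gm-equality : ∀ a b → 4 * (a * b) ≡ (a + b) * (a + b) → a ≡ b
am-gm-equality a b eq = ∣m-n∣≡0⇒m≡n (reduce (m*n≡0⇒m≡0∨n≡0 ∣ a - b ∣ square≡0))
  where
  square≡0 : ∣ a - b ∣ * ∣ a - b ∣ ≡ 0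
  square≡0 = +-cancelˡ-≡ (4 * (a * b)) _ _
    (trans (sym (square-of-sum a b)) (trans (sym eq) (sym (+-identityʳ _))))

module _ {n} (G : Graph n) where

  inNbrSymDiff : Fin n → Fin n → Fin n → Bool
  inNbrSymDiff u v w = not (w == u) ∧ not (w == v) ∧ (adj G u w xor adj G v w)

  nbrSymDiff : Fin n → Fin n → ℕ
  nbrSymDiff u v = count (inNbrSymDiff u v)

  nonAdj : Fin n → Fin n → Bool
  nonAdj w x = not (adj G w x) ∧ not (x == w)

  degreeᶜ : Fin n → ℕ
  degreeᶜ w = count (nonAdj w)

  𝟙-inNbrSymDiff : ∀ u v w →
    𝟙 (inNbrSymDiff u v w) ≡ 𝟙 (adj G w u) * 𝟙 (nonAdj w v) + 𝟙 (nonAdj w u) * 𝟙 (adj G w v)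
  𝟙-inNbrSymDiff u v w with w ≟ u | w ≟ v
  ... | yes refl | _ rewrite irrefl G w | ==-refl w = refl
  ... | no w≢u | yes refl rewrite irrefl G w | ==-refl w | ≢⇒==-false (≢-sym w≢u) with adj G w u
  ...   | false = refl
  ...   | true  = refl
  𝟙-inNbrSymDiff u v w | no w≢u | no w≢v
    rewrite ≢⇒==-false (≢-sym w≢u) | ≢⇒==-false (≢-sym w≢v) | adj-sym G u w | adj-sym G v w
    with adj G w u | adj G w v
  ... | false | false = refl
  ... | false | true  = refl
  ... | true  | false = refl
  ... | true  | true  = refl

  nbrSymDiff-sum : ∑[ u < n ] ∑[ v < n ] nbrSymDiff u v ≡ ∑[ w < n ] (2 * (degree G w * degreeᶜ w))
  nbrSymDiff-sum = begin
    ∑[ u < n ] ∑[ v < n ] nbrSymDiff u v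
      ≡⟨ sum-cong-≗ (λ u → sum-cong-≗ (λ v → count-sum (inNbrSymDiff u v))) ⟩
    ∑[ u < n ] ∑[ v < n ] ∑[ w < n ] 𝟙 (inNbrSymDiff u v w)
      ≡⟨ sum-cong-≗ (λ u → ∑-comm (λ v w → 𝟙 (inNbrSymDiff u v w))) ⟩
    ∑[ u < n ] ∑[ w < n ] ∑[ v < n ] 𝟙 (inNbrSymDiff u v w)
      ≡⟨ ∑-comm (λ u w → ∑[ v < n ] 𝟙 (inNbrSymDiff u v w)) ⟩
    ∑[ w < n ] ∑[ u < n ] ∑[ v < n ] 𝟙 (inNbrSymDiff u v w)
      ≡⟨ sum-cong-≗ (λ w → sum-cong-≗ (λ u → sum-cong-≗ (λ v → 𝟙-inNbrSymDiff u v w))) ⟩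
    ∑[ w < n ] ∑[ u < n ] ∑[ v < n ] (𝟙 (adj G w u) * 𝟙 (nonAdj w v) + 𝟙 (nonAdj w u) * 𝟙 (adj G w v))
      ≡⟨ sum-cong-≗ (λ w → sum-product-sym (𝟙 ∘ adj G w) (𝟙 ∘ nonAdj w)) ⟩
    ∑[ w < n ] (2 * (∑[ u < n ] 𝟙 (adj G w u) * ∑[ u < n ] 𝟙 (nonAdj w u)))
      ≡⟨ sum-cong-≗ (λ w → cong₂ (λ d dᶜ → 2 * (d * dᶜ)) (count-sum (adj G w)) (count-sum (nonAdj w))) ⟨
    ∑[ w < n ] (2 * (degree G w * degreeᶜ w))
      ∎
    where open ≡-Reasoning

  degree+degree : ∀ {u v} → u ≢ v →
    degree G u + degree G v ≡ nbrSymDiff u v + 2 * commonNbrs G u v + 2 * 𝟙 (adj G u v)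
  degree+degree {u} {v} u≢v = begin
    degree G u + degree G v
      ≡⟨ cong₂ _+_ (count-sum (adj G u)) (count-sum (adj G v)) ⟩
    ∑[ w < n ] 𝟙 (adj G u w) + ∑[ w < n ] 𝟙 (adj G v w)
      ≡⟨ ∑-distrib-+ (𝟙 ∘ adj G u) (𝟙 ∘ adj G v) ⟨
    ∑[ w < n ] (𝟙 (adj G u w) + 𝟙 (adj G v w))
      ≡⟨ sum-cong-≗ split ⟨
    ∑[ w < n ] (𝟙 (inNbrSymDiff u v w) + 2 * 𝟙 (common w) + (𝟙 (w == u) + 𝟙 (w == v)) * 𝟙 a)
      ≡⟨ ∑-distrib-+ (λ w → 𝟙 (inNbrSymDiff u v w) + 2 * 𝟙 (common w)) (λ w → (𝟙 (w == u) + 𝟙 (w == v)) * 𝟙 a) ⟩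
    ∑[ w < n ] (𝟙 (inNbrSymDiff u v w) + 2 * 𝟙 (common w)) + ∑[ w < n ] ((𝟙 (w == u) + 𝟙 (w == v)) * 𝟙 a)
      ≡⟨ cong₂ _+_ (∑-distrib-+ (𝟙 ∘ inNbrSymDiff u v) (λ w → 2 * 𝟙 (common w))) endpoints ⟩
    ∑[ w < n ] 𝟙 (inNbrSymDiff u v w) + ∑[ w < n ] (2 * 𝟙 (common w)) + 2 * 𝟙 a
      ≡⟨ cong (λ c → ∑[ w < n ] 𝟙 (inNbrSymDiff u v w) + c + 2 * 𝟙 a) (*-distribˡ-sum 2 (𝟙 ∘ common)) ⟨
    ∑[ w < n ] 𝟙 (inNbrSymDiff u v w) + 2 * ∑[ w < n ] 𝟙 (common w) + 2 * 𝟙 a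
      ≡⟨ cong₂ (λ d c → d + 2 * c + 2 * 𝟙 a) (count-sum (inNbrSymDiff u v)) (count-sum common) ⟨
    nbrSymDiff u v + 2 * commonNbrs G u v + 2 * 𝟙 a
      ∎
    where
    open ≡-Reasoning
    a = adj G u v
    common : Fin n → Bool
    common w = adj G u w ∧ adj G v w
    endpoints : ∑[ w < n ] ((𝟙 (w == u) + 𝟙 (w == v)) * 𝟙 a) ≡ 2 * 𝟙 a
    endpoints = begin
      ∑[ w < n ] ((𝟙 (w == u) + 𝟙 (w == v)) * 𝟙 a)
        ≡⟨ *-distribʳ-sum (𝟙 a) (λ w → 𝟙 (w == u) + 𝟙 (w == v)) ⟨
      ∑[ w < n ] (𝟙 (w == u) + 𝟙 (w == v)) * 𝟙 a
        ≡⟨ cong (_* 𝟙 a) (∑-distrib-+ (λ w → 𝟙 (w == u)) (λ w → 𝟙 (w == v))) ⟩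
      (∑[ w < n ] 𝟙 (w == u) + ∑[ w < n ] 𝟙 (w == v)) * 𝟙 a
        ≡⟨ cong₂ (λ x y → (x + y) * 𝟙 a) (sum-𝟙-== u) (sum-𝟙-== v) ⟩
      2 * 𝟙 a
        ∎
    split : ∀ w → 𝟙 (inNbrSymDiff u v w) + 2 * 𝟙 (common w) + (𝟙 (w == u) + 𝟙 (w == v)) * 𝟙 a
                  ≡ 𝟙 (adj G u w) + 𝟙 (adj G v w)
    split w with w ≟ u | w ≟ v
    ... | yes refl | yes refl = ⊥-elim (u≢v refl)
    ... | yes refl | no _ rewrite irrefl G u | adj-sym G v u with adj G u v
    ...   | false = refl
    ...   | true  = refl
    split w | no _ | yes refl rewrite irrefl G v with adj G u v
    ...   | false = refl
    ...   | true  = refl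
    split w | no _ | no _ with adj G u w | adj G v w
    ...   | false | false = refl
    ...   | false | true  = refl
    ...   | true  | false = refl
    ...   | true  | true  = refl

module MergeQuotient {n} (G : Graph n) {u v : Fin n} (u≢v : u ≢ v) where
  open Quot G u v

  Members : Fin n → List (Fin n) → Set
  Members p xs = ∀ {x} → T (inPart p x) ⇔ x ∈ xs

  rep-v : rep v ≡ u
  rep-v rewrite ==-refl v = refl

  rep-≢v : ∀ {x} → x ≢ v → rep x ≡ x
  rep-≢v x≢v rewrite ≢⇒==-false x≢v = refl

  members-merged : Members u (u ∷ v ∷ [])
  members-merged {x} = mk⇔ (to-∈ ∘ to T-==) (from T-== ∘ from-∈)
    where
    to-∈ : rep x ≡ u → x ∈ u ∷ v ∷ []
    to-∈ rx≡u with x ≟ v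
    ... | yes x≡v = there (here x≡v)
    ... | no  _   = here rx≡u
    from-∈ : x ∈ u ∷ v ∷ [] → rep x ≡ u
    from-∈ (here refl)         = rep-≢v u≢v
    from-∈ (there (here refl)) = rep-v

  members-single : ∀ {p} → p ≢ u → p ≢ v → Members p (p ∷ [])
  members-single {p} p≢u p≢v {x} = mk⇔ (to-∈ ∘ to T-==) (from T-== ∘ from-∈)
    where
    to-∈ : rep x ≡ p → x ∈ p ∷ []
    to-∈ rx≡p with x ≟ v
    ... | yes _ = ⊥-elim (p≢u (sym rx≡p))
    ... | no  _ = here rx≡p
    from-∈ : x ∈ p ∷ [] → rep x ≡ p
    from-∈ (here refl) = rep-≢v p≢v

  someEdge-≡ : ∀ {p q xs ys} → Members p xs → Members q ys →
               someEdge p q ≡ any (λ x → any (adj G x) ys) xs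
  someEdge-≡ {p} {q} {xs} {ys} p∼xs q∼ys = T-ext edge⇒ edge⇐
    where
    edge⇒ : T (someEdge p q) → T (any (λ x → any (adj G x) ys) xs)
    edge⇒ t =
      let x , tx      = to (T-any-allFin {n}) t
          y , txy     = to (T-any-allFin {n}) tx
          px , qy∧axy = to (T-∧ {inPart p x}) txy
          qy , axy    = to (T-∧ {inPart q y}) qy∧axy
      in any⁺ _ (lose (to p∼xs px) (any⁺ _ (lose (to q∼ys qy) axy)))
    edge⇐ : T (any (λ x → any (adj G x) ys) xs) → T (someEdge p q)
    edge⇐ t =
      let x , x∈xs , tx  = find (any⁻ _ xs t)
          y , y∈ys , axy = find (any⁻ _ ys tx)
      in from (T-any-allFin {n}) (x , from (T-any-allFin {n})
           (y , from (T-∧ {inPart p x}) (from p∼xs x∈xs , from (T-∧ {inPart q y}) (from q∼ys y∈ys , axy))))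

  allEdge-≡ : ∀ {p q xs ys} → Members p xs → Members q ys →
              allEdge p q ≡ all (λ x → all (adj G x) ys) xs
  allEdge-≡ {p} {q} {xs} {ys} p∼xs q∼ys = T-ext edges⇒ edges⇐
    where
    edges⇒ : T (allEdge p q) → T (all (λ x → all (adj G x) ys) xs)
    edges⇒ t = all⁻ _ (All.tabulate λ {x} x∈xs → all⁻ _ (All.tabulate λ {y} y∈ys →
      to (T-not∨⇔→ {inPart p x ∧ inPart q y}) (to (T-all-allFin {n}) (to (T-all-allFin {n}) t x) y)
         (from (T-∧ {inPart p x}) (from p∼xs x∈xs , from q∼ys y∈ys))))
    edges⇐ : T (all (λ x → all (adj G x) ys) xs) → T (allEdge p q)
    edges⇐ t = from (T-all-allFin {n}) λ x → from (T-all-allFin {n}) λ y →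
      from (T-not∨⇔→ {inPart p x ∧ inPart q y}) λ px∧qy →
        let px , qy = to (T-∧ {inPart p x}) px∧qy
        in All.lookup (all⁺ _ ys (All.lookup (all⁺ _ xs t) (to p∼xs px))) (to q∼ys qy)

  red-from-merged : ∀ {q} → q ≢ u → q ≢ v → red u q ≡ adj G u q xor adj G v q
  red-from-merged {q} q≢u q≢v
    rewrite ≢⇒==-false (≢-sym q≢u)
          | someEdge-≡ members-merged (members-single q≢u q≢v)
          | allEdge-≡ members-merged (members-single q≢u q≢v)
    with adj G u q | adj G v q
  ... | false | false = refl
  ... | false | true  = refl
  ... | true  | false = refl
  ... | true  | true  = refl

  red-to-merged : ∀ {p} → p ≢ u → p ≢ v → red p u ≡ adj G u p xor adj G v p
  red-to-merged {p} p≢u p≢v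
    rewrite ≢⇒==-false p≢u
          | someEdge-≡ (members-single p≢u p≢v) members-merged
          | allEdge-≡ (members-single p≢u p≢v) members-merged
          | adj-sym G u p | adj-sym G v p
    with adj G p u | adj G p v
  ... | false | false = refl
  ... | false | true  = refl
  ... | true  | false = refl
  ... | true  | true  = refl

  red-between-singles : ∀ {p q} → p ≢ u → p ≢ v → q ≢ u → q ≢ v → red p q ≡ false
  red-between-singles {p} {q} p≢u p≢v q≢u q≢v with p ≟ q
  ... | yes refl = refl
  ... | no  _
    rewrite someEdge-≡ (members-single p≢u p≢v) (members-single q≢u q≢v)
          | allEdge-≡ (members-single p≢u p≢v) (members-single q≢u q≢v)
    with adj G p q
  ... | false = refl
  ... | true  = refl

  redDegree-merged : redDegree u ≡ nbrSymDiff G u v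
  redDegree-merged = count-cong red-u
    where
    red-u : ∀ q → isPart q ∧ red u q ≡ inNbrSymDiff G u v q
    red-u q with q ≟ u
    ... | yes refl rewrite ==-refl u | ≢⇒==-false u≢v = refl
    ... | no q≢u with q ≟ v
    ...   | yes refl = refl
    ...   | no q≢v rewrite red-from-merged q≢u q≢v = refl

  redDegree-single : ∀ {p} → p ≢ u → p ≢ v → redDegree p ≡ 𝟙 (inNbrSymDiff G u v p)
  redDegree-single {p} p≢u p≢v = begin
    redDegree p                              ≡⟨ count-sum (λ q → isPart q ∧ red p q) ⟩
    ∑[ q < n ] 𝟙 (isPart q ∧ red p q)        ≡⟨ sum-cong-≗ (λ q → trans (cong 𝟙 (red-p q)) (𝟙-∧ (q == u) d)) ⟩
    ∑[ q < n ] (𝟙 (q == u) * 𝟙 d)            ≡⟨ *-distribʳ-sum (𝟙 d) (λ q → 𝟙 (q == u)) ⟨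
    ∑[ q < n ] 𝟙 (q == u) * 𝟙 d              ≡⟨ cong (_* 𝟙 d) (sum-𝟙-== u) ⟩
    1 * 𝟙 d                                  ≡⟨ *-identityˡ (𝟙 d) ⟩
    𝟙 d                                      ∎
    where
    open ≡-Reasoning
    d = inNbrSymDiff G u v p
    red-p : ∀ q → isPart q ∧ red p q ≡ (q == u) ∧ d
    red-p q with q ≟ u
    ... | yes refl
      rewrite red-to-merged p≢u p≢v | ≢⇒==-false u≢v | ≢⇒==-false p≢u | ≢⇒==-false p≢v = refl
    ... | no q≢u with q ≟ v
    ...   | yes refl = refl
    ...   | no q≢v = red-between-singles p≢u p≢v q≢u q≢v

  maxRedDegree-≡ : maxRedDegree ≡ nbrSymDiff G u v
  maxRedDegree-≡ =
    ≤-antisym (maxL-≤ (All.tabulate bounded)) (subst (_≤ maxRedDegree) redDegree-merged (≤-maxL u∈))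
    where
    u∈ : redDegree u ∈ map redDegree (filterᵇ isPart (allFin n))
    u∈ = ∈-map∘filter⁺ redDegree (T? ∘ isPart) (u , ∈-allFin u , refl , from T-not-== u≢v)
    bounded : ∀ {r} → r ∈ map redDegree (filterᵇ isPart (allFin n)) → r ≤ nbrSymDiff G u v
    bounded r∈ with ∈-map∘filter⁻ redDegree (T? ∘ isPart) {xs = allFin n} r∈
    ... | p , _ , refl , p-part with p ≟ u
    ...   | yes refl = ≤-reflexive redDegree-merged
    ...   | no p≢u   = subst (_≤ nbrSymDiff G u v) (sym (redDegree-single p≢u (to T-not-== p-part)))
                             (𝟙≤count (inNbrSymDiff G u v) p)

module _ {n} (G : Graph n) where
  open Quot G using (maxRedDegree)

  private
    redDegreeValues : List ℕ
    redDegreeValues = concatMap (λ u → concatMap (λ v →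
      if u == v then [] else (maxRedDegree u v ∷ [])) (allFin n)) (allFin n)

    ∈-redDegreeValues : ∀ {u v} → u ≢ v → maxRedDegree u v ∈ redDegreeValues
    ∈-redDegreeValues {u} {v} u≢v =
      ∈-concatMap⁺ _ (lose (∈-allFin u) (∈-concatMap⁺ _ (lose (∈-allFin v) singleton)))
      where
      singleton : maxRedDegree u v ∈ (if u == v then [] else (maxRedDegree u v ∷ []))
      singleton rewrite ≢⇒==-false u≢v = here refl

    redDegreeValues-∈ : ∀ {r} → r ∈ redDegreeValues → ∃[ u ] ∃[ v ] u ≢ v × r ≡ maxRedDegree u v
    redDegreeValues-∈ r∈ with find (∈-concatMap⁻ _ {xs = allFin n} r∈)
    ... | u , _ , r∈u with find (∈-concatMap⁻ _ {xs = allFin n} r∈u)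
    ...   | v , _ , r∈uv with u ≟ v | r∈uv
    ...     | no u≢v | here r≡ = u , v , u≢v , r≡

    lb₁≡minL : lb₁ G ≡ minL redDegreeValues
    lb₁≡minL = refl

  lb₁≤nbrSymDiff : ∀ {u v} → u ≢ v → lb₁ G ≤ nbrSymDiff G u v
  lb₁≤nbrSymDiff {u} {v} u≢v =
    subst₂ _≤_ (sym lb₁≡minL) (MergeQuotient.maxRedDegree-≡ G u≢v) (minL-≤ (∈-redDegreeValues u≢v))

  lb₁-elim : (P : ℕ → Set) → (∀ {u v} → u ≢ v → P (nbrSymDiff G u v)) → ∀ {u v} → u ≢ v → P (lb₁ G)
  lb₁-elim P P-pairs u≢v = from-witness (redDegreeValues-∈ (minL-∈ (∈-redDegreeValues u≢v)))
    where
    from-witness : (∃[ u′ ] ∃[ v′ ] u′ ≢ v′ × minL redDegreeValues ≡ maxRedDegree u′ v′) → P (lb₁ G)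
    from-witness (u′ , v′ , u′≢v′ , min≡) =
      subst P (sym (trans lb₁≡minL (trans min≡ (MergeQuotient.maxRedDegree-≡ G u′≢v′)))) (P-pairs u′≢v′)

ConferenceConditions : ∀ {m} → Graph (suc m) → Set
ConferenceConditions {m} G =
  (∀ x → 2 * degree G x ≡ m) × (∀ x y → x ≢ y → 4 * commonNbrs G x y + 4 * 𝟙 (adj G x y) ≡ m)

conference⇔ : ∀ {m} {G : Graph (suc m)} → Conference G ⇔ ConferenceConditions G
conference⇔ {m} {G} = mk⇔ to-conditions from-conditions
  where
  to-conditions : Conference G → ConferenceConditions G
  to-conditions (degree≡ , adjacent≡ , nonadjacent≡) = half , common
    where
    half : ∀ x → 2 * degree G x ≡ m
    half x = suc-injective (trans (+-comm 1 _) (degree≡ x))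
    common : ∀ x y → x ≢ y → 4 * commonNbrs G x y + 4 * 𝟙 (adj G x y) ≡ m
    common x y x≢y with adj G x y in x~y
    ... | true  = suc-injective (trans (sym (+-suc _ 4)) (adjacent≡ x y x≢y x~y))
    ... | false = suc-injective (trans (sym (+-suc _ 0)) (nonadjacent≡ x y x≢y x~y))
  from-conditions : ConferenceConditions G → Conference G
  from-conditions (half , common) =
      (λ x → trans (+-comm _ 1) (cong suc (half x)))
    , (λ x y x≢y x~y → trans (+-suc _ 4) (cong suc (common-at x y x≢y x~y)))
    , (λ x y x≢y x≁y → trans (+-suc _ 0) (cong suc (common-at x y x≢y x≁y)))
    where
    common-at : ∀ x y → x ≢ y → ∀ {b} → adj G x y ≡ b → 4 * commonNbrs G x y + 4 * 𝟙 b ≡ m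
    common-at x y x≢y refl = common x y x≢y

module _ {m} (G : Graph (suc m)) where

  degree+degreeᶜ : ∀ w → degree G w + degreeᶜ G w ≡ m
  degree+degreeᶜ w = begin
    degree G w + degreeᶜ G w
      ≡⟨ cong₂ _+_ (count-sum (adj G w)) (count-sum (nonAdj G w)) ⟩
    ∑[ x < suc m ] 𝟙 (adj G w x) + ∑[ x < suc m ] 𝟙 (nonAdj G w x)
      ≡⟨ ∑-distrib-+ (𝟙 ∘ adj G w) (𝟙 ∘ nonAdj G w) ⟨
    ∑[ x < suc m ] (𝟙 (adj G w x) + 𝟙 (nonAdj G w x))
      ≡⟨ sum-cong-≗ partition ⟩
    ∑[ x < suc m ] 𝟙 (not (x == w))
      ≡⟨ sum-𝟙-not-== w ⟩
    m ∎
    where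
    open ≡-Reasoning
    partition : ∀ x → 𝟙 (adj G w x) + 𝟙 (nonAdj G w x) ≡ 𝟙 (not (x == w))
    partition x with x ≟ w
    ... | yes refl rewrite irrefl G x = refl
    ... | no _ with adj G w x
    ...   | false = refl
    ...   | true  = refl

  degree-am-gm : ∀ w → 4 * (degree G w * degreeᶜ G w) ≤ m * m
  degree-am-gm w =
    subst (λ k → 4 * (degree G w * degreeᶜ G w) ≤ k * k) (degree+degreeᶜ w) (am-gm (degree G w) (degreeᶜ G w))

  pair-identity : (∀ x → 2 * degree G x ≡ m) → ∀ {u v} → u ≢ v →
    2 * nbrSymDiff G u v + (4 * commonNbrs G u v + 4 * 𝟙 (adj G u v)) ≡ m + m
  pair-identity half {u} {v} u≢v = begin
    2 * nbrSymDiff G u v + (4 * commonNbrs G u v + 4 * 𝟙 (adj G u v))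
      ≡⟨ distribute (nbrSymDiff G u v) (commonNbrs G u v) (𝟙 (adj G u v)) ⟨
    2 * (nbrSymDiff G u v + 2 * commonNbrs G u v + 2 * 𝟙 (adj G u v))
      ≡⟨ cong (2 *_) (degree+degree G u≢v) ⟨
    2 * (degree G u + degree G v)
      ≡⟨ *-distribˡ-+ 2 (degree G u) (degree G v) ⟩
    2 * degree G u + 2 * degree G v
      ≡⟨ cong₂ _+_ (half u) (half v) ⟩
    m + m
      ∎
    where
    open ≡-Reasoning
    distribute : ∀ d c k → 2 * (d + 2 * c + 2 * k) ≡ 2 * d + (4 * c + 4 * k)
    distribute = solve-∀

  conference⇒nbrSymDiff : ConferenceConditions G → ∀ {u v} → u ≢ v → 2 * nbrSymDiff G u v ≡ m
  conference⇒nbrSymDiff (half , common) {u} {v} u≢v = +-cancelʳ-≡ m _ _ (begin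
    2 * nbrSymDiff G u v + m
      ≡⟨ cong (2 * nbrSymDiff G u v +_) (common u v u≢v) ⟨
    2 * nbrSymDiff G u v + (4 * commonNbrs G u v + 4 * 𝟙 (adj G u v))
      ≡⟨ pair-identity half u≢v ⟩
    m + m
      ∎)
    where open ≡-Reasoning

  private
    L = lb₁ G

  pairSum : ℕ
  pairSum = ∑[ u < suc m ] ∑[ v < suc m ] nbrSymDiff G u v

  lb₁PairSum : ℕ
  lb₁PairSum = ∑[ u < suc m ] ∑[ v < suc m ] (𝟙 (not (v == u)) * L)

  lb₁-term≤nbrSymDiff : ∀ u v → 𝟙 (not (v == u)) * L ≤ nbrSymDiff G u v
  lb₁-term≤nbrSymDiff u v with v ≟ u
  ... | yes _   = z≤n
  ... | no  v≢u = ≤-trans (≤-reflexive (+-identityʳ L)) (lb₁≤nbrSymDiff G (≢-sym v≢u))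

  lb₁PairSum≤pairSum : lb₁PairSum ≤ pairSum
  lb₁PairSum≤pairSum = sum-mono-≤ (λ u → sum-mono-≤ (lb₁-term≤nbrSymDiff u))

  twice-lb₁PairSum : 2 * lb₁PairSum ≡ suc m * (m * (2 * L))
  twice-lb₁PairSum = begin
    2 * lb₁PairSum         ≡⟨ cong (2 *_) (trans (sum-cong-≗ row) (sum-const (suc m) (m * L))) ⟩
    2 * (suc m * (m * L))  ≡⟨ rearrange (suc m) m L ⟩
    suc m * (m * (2 * L))  ∎
    where
    open ≡-Reasoning
    row : ∀ u → ∑[ v < suc m ] (𝟙 (not (v == u)) * L) ≡ m * L
    row u = trans (sym (*-distribʳ-sum L (λ v → 𝟙 (not (v == u))))) (cong (_* L) (sum-𝟙-not-== u))
    rearrange : ∀ a b c → 2 * (a * (b * c)) ≡ a * (b * (2 * c))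
    rearrange = solve-∀

  twice-pairSum : 2 * pairSum ≡ ∑[ w < suc m ] (4 * (degree G w * degreeᶜ G w))
  twice-pairSum = begin
    2 * pairSum
      ≡⟨ cong (2 *_) (nbrSymDiff-sum G) ⟩
    2 * ∑[ w < suc m ] (2 * (degree G w * degreeᶜ G w))
      ≡⟨ *-distribˡ-sum 2 (λ w → 2 * (degree G w * degreeᶜ G w)) ⟩
    ∑[ w < suc m ] (2 * (2 * (degree G w * degreeᶜ G w)))
      ≡⟨ sum-cong-≗ (λ w → *-assoc 2 2 (degree G w * degreeᶜ G w)) ⟨
    ∑[ w < suc m ] (4 * (degree G w * degreeᶜ G w))
      ∎
    where open ≡-Reasoning

  twice-pairSum≤ : 2 * pairSum ≤ suc m * (m * m)
  twice-pairSum≤ = begin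
    2 * pairSum                                      ≡⟨ twice-pairSum ⟩
    ∑[ w < suc m ] (4 * (degree G w * degreeᶜ G w))  ≤⟨ sum-mono-≤ degree-am-gm ⟩
    ∑[ w < suc m ] (m * m)                           ≡⟨ sum-const (suc m) (m * m) ⟩
    suc m * (m * m)                                  ∎
    where open ≤-Reasoning

  counting-bound : suc m * (m * (2 * L)) ≤ suc m * (m * m)
  counting-bound = begin
    suc m * (m * (2 * L))  ≡⟨ twice-lb₁PairSum ⟨
    2 * lb₁PairSum         ≤⟨ *-monoʳ-≤ 2 lb₁PairSum≤pairSum ⟩
    2 * pairSum            ≤⟨ twice-pairSum≤ ⟩
    suc m * (m * m)        ∎
    where open ≤-Reasoning

  module Extremal (extremal : 2 * lb₁ G ≡ m) where

    twice-lb₁PairSum≡ : 2 * lb₁PairSum ≡ suc m * (m * m)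
    twice-lb₁PairSum≡ = trans twice-lb₁PairSum (cong (λ k → suc m * (m * k)) extremal)

    pairSum≤lb₁PairSum : pairSum ≤ lb₁PairSum
    pairSum≤lb₁PairSum = *-cancelˡ-≤ 2 (≤-trans twice-pairSum≤ (≤-reflexive (sym twice-lb₁PairSum≡)))

    am-gm-tight : ∀ w → 4 * (degree G w * degreeᶜ G w) ≡ m * m
    am-gm-tight = sum-tight degree-am-gm (begin
      ∑[ w < suc m ] (m * m)                            ≡⟨ sum-const (suc m) (m * m) ⟩
      suc m * (m * m)                                  ≡⟨ twice-lb₁PairSum≡ ⟨
      2 * lb₁PairSum                                   ≤⟨ *-monoʳ-≤ 2 lb₁PairSum≤pairSum ⟩
      2 * pairSum                                      ≡⟨ twice-pairSum ⟩
      ∑[ w < suc m ] (4 * (degree G w * degreeᶜ G w))  ∎)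
      where open ≤-Reasoning

    nbrSymDiff≡lb₁ : ∀ {u v} → u ≢ v → nbrSymDiff G u v ≡ L
    nbrSymDiff≡lb₁ {u} {v} u≢v = begin
      nbrSymDiff G u v      ≡⟨ entries u v ⟨
      𝟙 (not (v == u)) * L  ≡⟨ cong (λ b → 𝟙 (not b) * L) (≢⇒==-false (≢-sym u≢v)) ⟩
      1 * L                 ≡⟨ *-identityˡ L ⟩
      L                     ∎
      where
      open ≡-Reasoning
      rows : ∀ u → ∑[ v < suc m ] (𝟙 (not (v == u)) * L) ≡ ∑[ v < suc m ] nbrSymDiff G u v
      rows = sum-tight (λ u → sum-mono-≤ (lb₁-term≤nbrSymDiff u)) pairSum≤lb₁PairSum
      entries : ∀ u v → 𝟙 (not (v == u)) * L ≡ nbrSymDiff G u v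
      entries u = sum-tight (lb₁-term≤nbrSymDiff u) (≤-reflexive (sym (rows u)))

    half-degree : ∀ w → 2 * degree G w ≡ m
    half-degree w = begin
      2 * degree G w            ≡⟨ cong (degree G w +_) (+-identityʳ (degree G w)) ⟩
      degree G w + degree G w   ≡⟨ cong (degree G w +_) balanced ⟩
      degree G w + degreeᶜ G w  ≡⟨ degree+degreeᶜ w ⟩
      m                         ∎
      where
      open ≡-Reasoning
      balanced : degree G w ≡ degreeᶜ G w
      balanced = am-gm-equality _ _ (trans (am-gm-tight w) (cong (λ k → k * k) (sym (degree+degreeᶜ w))))

    common-condition : ∀ x y → x ≢ y → 4 * commonNbrs G x y + 4 * 𝟙 (adj G x y) ≡ m
    common-condition x y x≢y = +-cancelˡ-≡ m _ _ (begin
      m + (4 * commonNbrs G x y + 4 * 𝟙 (adj G x y))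
        ≡⟨ cong (_+ (4 * commonNbrs G x y + 4 * 𝟙 (adj G x y))) twice-nbrSymDiff ⟨
      2 * nbrSymDiff G x y + (4 * commonNbrs G x y + 4 * 𝟙 (adj G x y))
        ≡⟨ pair-identity half-degree x≢y ⟩
      m + m
        ∎)
      where
      open ≡-Reasoning
      twice-nbrSymDiff : 2 * nbrSymDiff G x y ≡ m
      twice-nbrSymDiff = trans (cong (2 *_) (nbrSymDiff≡lb₁ x≢y)) extremal

    conditions : ConferenceConditions G
    conditions = half-degree , common-condition

-- With a single vertex there is no pair to merge, and lb₁ G computes to 0.
lb₁-bound : ∀ {m} (G : Graph (suc m)) → 2 * lb₁ G ≤ m
lb₁-bound {zero}  G = z≤n
lb₁-bound {suc k} G = *-cancelˡ-≤ (suc k) (*-cancelˡ-≤ (2 + k) (counting-bound G))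

conference⇒extremal : ∀ {m} (G : Graph (suc m)) → ConferenceConditions G → 2 * lb₁ G ≡ m
conference⇒extremal {zero}  G _ = refl
conference⇒extremal {suc k} G conf =
  lb₁-elim G (λ l → 2 * l ≡ suc k) (conference⇒nbrSymDiff G conf) {zero} {suc zero} (λ ())

theorem4p1 : (n : ℕ) → 1 ≤ n → (G : Graph n) →
    (2 * lb₁ G ≤ n ∸ 1) × ((2 * lb₁ G ≡ n ∸ 1) ⇔ Conference G)
theorem4p1 (suc m) _ G =
    lb₁-bound G
  , mk⇔ (from (conference⇔ {G = G}) ∘ Extremal.conditions G) (conference⇒extremal G ∘ to (conference⇔ {G = G}))
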